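{- Let $\mathcal{S}$ be any one of the five step sets $\mathcal{A},\mathcal{B},\mathcal{C},\mathcal{D},\mathcal{E}$. Then the power series $Q_{\mathcal{S}}(x,y,\tfrac12)=\sum_{i,j\ge0}\Big(\sum_{n\ge0}\#_{\mathcal{S}}\{(0,0)\stackrel{n}{\to}(i,j)\}\,2^{ -n}\Big)x^iy^j$ is well defined in $\mathbb{R}[[x,y]]$, meaning that all its coefficients are finite.
   Context: Write N=(0,1), E=(1,0), NE=(1,1), NW=(-1,1), SE=(1,-1). The step sets are $\mathcal{A}=\{\mathrm{NW},\mathrm{NE},\mathrm{SE}\}$, $\mathcal{B}=\{\mathrm{NW},\mathrm{N},\mathrm{E},\mathrm{SE}\}$, $\mathcal{C}=\{\mathrm{NW},\mathrm{N},\mathrm{NE},\mathrm{E},\mathrm{SE}\}$, $\mathcal{D}=\{\mathrm{NW},\mathrm{N},\mathrm{SE}\}$, $\mathcal{E}=\{\mathrm{NW},\mathrm{N},\mathrm{NE},\mathrm{SE}\}$. For a step set $\mathcal{S}$, $\#_{\mathcal{S}}\{(0,0)\stackrel{n}{\to}(i,j)\}$ denotes the number of walks of length $n$ with steps in $\mathcal{S}$, starting at $(0,0)$, ending at $(i,j)$, all of whose points lie in $\mathbb{N}^2$; $Q_{\mathcal{S}}(x,y,t)=\sum_{i,j,n\ge0}\#_{\mathcal{S}}\{(0,0)\stackrel{n}{\to}(i,j)\}x^iy^jt^n$. -}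

module Defs where

open import Data.Nat using (ℕ; zero; suc)
open import Data.Integer as ℤ using (ℤ; +_; -[1+_]; 0ℤ; 1ℤ; -1ℤ)
open import Data.Integer.Properties as ℤP using ()
open import Data.Rational as ℚ using (ℚ; ½; 0ℚ; 1ℚ)
open import Data.Product using (_×_; _,_; proj₁; proj₂)
open import Data.Product.Properties using (≡-dec)
open import Data.List using (List; []; _∷_; map; concatMap; length; filter)
open import Data.List.Relation.Unary.All as All using (All; all?)
open import Relation.Binary.PropositionalEquality using (_≡_)
open import Relation.Nullary.Decidable using (Dec; _×-dec_)

Point : Set
Point = ℤ × ℤ

_⊕_ : Point → Point → Point
(a , b) ⊕ (c , d) = (a ℤ.+ c , b ℤ.+ d)

N E NE NW SE : Point
N  = (0ℤ , 1ℤ)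
E  = (1ℤ , 0ℤ)
NE = (1ℤ , 1ℤ)
NW = (-1ℤ , 1ℤ)
SE = (1ℤ , -1ℤ)

data Model : Set where
  𝒜 ℬ 𝒞 𝒟 ℰ : Model

steps : Model → List Point
steps 𝒜 = NW ∷ NE ∷ SE ∷ []
steps ℬ = NW ∷ N ∷ E ∷ SE ∷ []
steps 𝒞 = NW ∷ N ∷ NE ∷ E ∷ SE ∷ []
steps 𝒟 = NW ∷ N ∷ SE ∷ []
steps ℰ = NW ∷ N ∷ NE ∷ SE ∷ []

words : List Point → ℕ → List (List Point)
words S zero    = [] ∷ []
words S (suc n) = concatMap (λ s → map (s ∷_) (words S n)) S

visited : Point → List Point → List Point
visited p []       = []
visited p (s ∷ ss) = (p ⊕ s) ∷ visited (p ⊕ s) ss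

endpoint : Point → List Point → Point
endpoint p []       = p
endpoint p (s ∷ ss) = endpoint (p ⊕ s) ss

origin : Point
origin = (0ℤ , 0ℤ)

InQuadrant : Point → Set
InQuadrant (a , b) = (0ℤ ℤ.≤ a) × (0ℤ ℤ.≤ b)

inQuadrant? : (p : Point) → Dec (InQuadrant p)
inQuadrant? (a , b) = (0ℤ ℤ.≤? a) ×-dec (0ℤ ℤ.≤? b)

-- the walk w from the origin stays in ℕ² (origin itself is in ℕ²) and ends at q
GoodWalk : Point → List Point → Set
GoodWalk q w = All InQuadrant (visited origin w) × (endpoint origin w ≡ q)

goodWalk? : (q : Point) → (w : List Point) → Dec (GoodWalk q w)
goodWalk? q w = all? inQuadrant? (visited origin w) ×-dec ≡-dec ℤ._≟_ ℤ._≟_ (endpoint origin w) q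

count : Model → ℕ → ℕ → ℕ → ℕ
count S n i j = length (filter (goodWalk? (+ i , + j)) (words (steps S) n))

half^ : ℕ → ℚ
half^ zero    = 1ℚ
half^ (suc n) = ½ ℚ.* half^ n

partialCoeff : Model → ℕ → ℕ → ℕ → ℚ
partialCoeff S i j zero    = (+ count S 0 i j) ℚ./ 1
partialCoeff S i j (suc N) =
  partialCoeff S i j N ℚ.+ ((+ count S (suc N) i j) ℚ./ 1) ℚ.* half^ (suc N)

{-# OPTIONS --safe #-}
module Submission where

-- The coefficient of x^i y^j is the value at the origin of the Green function
-- G(p) = Σ_n 2^(-n) · #{n-step quadrant walks p → q}, q = (i , j).  Any h ≥ 0 with
-- h(p) ≥ [p = q] + ½ Σ_s h(p + s) on ℕ² bounds every partial sum of G, so it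
-- suffices to exhibit such an h.  Every step set is contained in 𝒞, whose steps
-- never decrease the level x + y, so only levels k ≤ K = i + j matter; take
-- h(x , y) = (x + 1)(y + 1) c^(K - x - y) there, 0 above, with c = 2(K + 1)².
-- Along a level the steps NW and SE average (x + 1)(y + 1) to (x + 1)(y + 1) - 1;
-- this deficit c^(K - k) pays for the source at q and, thanks to the factor c,
-- for the steps N, NE, E to the levels above.

open import Defs
open import Data.Bool using (true; false; if_then_else_)
import Data.Integer as ℤ
open import Data.Integer using (0ℤ)
import Data.Integer.Properties as ℤP
open import Data.List using (List; []; _∷_; _++_; map; concatMap; length; filter)
open import Data.List.Properties using (length-++; filter-++; filter-≐; filter-none; map-cong)
open import Data.List.Relation.Binary.Sublist.Propositional using (_⊆_; []; _∷_; _∷ʳ_)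
open import Data.List.Relation.Unary.All as All using (All; _∷_)
open import Data.Nat as ℕ using (ℕ; zero; suc; _+_; _*_; _^_; _≤_; _<_; z≤n; s≤s)
open import Data.Nat.ListAction using (sum)
import Data.Nat.Properties as ℕP
open import Data.Nat.Tactic.RingSolver using (solve-∀)
open import Data.Product using (∃; _×_; _,_)
open import Data.Product.Properties using (≡-dec)
open import Data.Rational as ℚ using (ℚ; ½; 1ℚ)
import Data.Rational.Properties as ℚP
import Data.Rational.Unnormalised as ℚᵘ
import Data.Rational.Unnormalised.Properties as ℚᵘP
open import Data.Rational.Solver using (module +-*-Solver)
open import Function using (_∘_)
open import Level using (Level)
open import Relation.Binary.Definitions using (DecidableEquality)
open import Relation.Binary.PropositionalEquality
open import Relation.Nullary using (Dec; yes; no; does; ¬_)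
open import Relation.Nullary.Decidable using (_×-dec_)
open import Relation.Unary using (Pred; Decidable; _≐_)

private
  variable
    ℓ ℓ′ : Level
    A B : Set ℓ

sum-map-+-* : ∀ k (f g : A → ℕ) xs →
              sum (map (λ x → k * f x + g x) xs) ≡ k * sum (map f xs) + sum (map g xs)
sum-map-+-* k f g [] = sym (cong (_+ 0) (ℕP.*-zeroʳ k))
sum-map-+-* k f g (x ∷ xs) = begin
  k * f x + g x + sum (map (λ x → k * f x + g x) xs)
    ≡⟨ cong ((k * f x + g x) +_) (sum-map-+-* k f g xs) ⟩
  k * f x + g x + (k * sum (map f xs) + sum (map g xs))
    ≡⟨ regroup k (f x) (g x) _ _ ⟩
  k * (f x + sum (map f xs)) + (g x + sum (map g xs)) ∎
  where
  open ≡-Reasoning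
  regroup : ∀ k a b A B → k * a + b + (k * A + B) ≡ k * (a + A) + (b + B)
  regroup = solve-∀

sum-map-*ˡ : ∀ k (f : A → ℕ) xs → sum (map (λ x → k * f x) xs) ≡ k * sum (map f xs)
sum-map-*ˡ k f []       = sym (ℕP.*-zeroʳ k)
sum-map-*ˡ k f (x ∷ xs) =
  trans (cong (k * f x +_) (sum-map-*ˡ k f xs)) (sym (ℕP.*-distribˡ-+ k (f x) _))

sum-map-mono-≤ : ∀ {f g : A → ℕ} → (∀ x → f x ≤ g x) →
                 ∀ xs → sum (map f xs) ≤ sum (map g xs)
sum-map-mono-≤ f≤g []       = z≤n
sum-map-mono-≤ f≤g (x ∷ xs) = ℕP.+-mono-≤ (f≤g x) (sum-map-mono-≤ f≤g xs)

sum-map-⊆ : ∀ (f : A → ℕ) {xs ys} → xs ⊆ ys → sum (map f xs) ≤ sum (map f ys)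
sum-map-⊆ f []            = z≤n
sum-map-⊆ f (y ∷ʳ xs⊆ys)  = ℕP.≤-trans (sum-map-⊆ f xs⊆ys) (ℕP.m≤n+m _ (f y))
sum-map-⊆ f (refl ∷ xs⊆ys) = ℕP.+-monoʳ-≤ _ (sum-map-⊆ f xs⊆ys)

length-filter-map : ∀ {P : Pred B ℓ′} (P? : Decidable P) (f : A → B) xs →
                    length (filter P? (map f xs)) ≡ length (filter (P? ∘ f) xs)
length-filter-map P? f [] = refl
length-filter-map P? f (x ∷ xs) with does (P? (f x))
... | true  = cong suc (length-filter-map P? f xs)
... | false = length-filter-map P? f xs

length-filter-concatMap : ∀ {P : Pred B ℓ′} (P? : Decidable P) (f : A → List B) xs →
                          length (filter P? (concatMap f xs))
                            ≡ sum (map (λ x → length (filter P? (f x))) xs)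
length-filter-concatMap P? f [] = refl
length-filter-concatMap P? f (x ∷ xs) = begin
  length (filter P? (f x ++ concatMap f xs))
    ≡⟨ cong length (filter-++ P? (f x) (concatMap f xs)) ⟩
  length (filter P? (f x) ++ filter P? (concatMap f xs))
    ≡⟨ length-++ (filter P? (f x)) ⟩
  length (filter P? (f x)) + length (filter P? (concatMap f xs))
    ≡⟨ cong (length (filter P? (f x)) +_) (length-filter-concatMap P? f xs) ⟩
  length (filter P? (f x)) + sum (map (λ x → length (filter P? (f x))) xs) ∎
  where open ≡-Reasoning

_≟ₚ_ : DecidableEquality Point
_≟ₚ_ = ≡-dec ℤ._≟_ ℤ._≟_

ifInQuadrant : Point → ℕ → ℕ
ifInQuadrant r v = if does (inQuadrant? r) then v else 0

ifInQuadrant-+-* : ∀ r k u v → ifInQuadrant r (k * u + v) ≡ k * ifInQuadrant r u + ifInQuadrant r v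
ifInQuadrant-+-* r k u v with does (inQuadrant? r)
... | true  = refl
... | false = cong (_+ 0) (sym (ℕP.*-zeroʳ k))

ifInQuadrant-≤ : ∀ r {u v} → (InQuadrant r → u ≤ v) → ifInQuadrant r u ≤ v
ifInQuadrant-≤ (a , b) u≤v with 0ℤ ℤ.≤? a | 0ℤ ℤ.≤? b
... | yes 0≤a | yes 0≤b = u≤v (0≤a , 0≤b)
... | yes _   | no  _   = z≤n
... | no  _   | _       = z≤n

quadrantWalks : List Point → Point → ℕ → Point → ℕ
quadrantWalks S q zero    p = if does (p ≟ₚ q) then 1 else 0
quadrantWalks S q (suc n) p = sum (map (λ s → ifInQuadrant (p ⊕ s) (quadrantWalks S q n (p ⊕ s))) S)

GoodFrom : Point → Point → List Point → Set
GoodFrom p q w = All InQuadrant (visited p w) × endpoint p w ≡ q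

goodFrom? : ∀ p q → Decidable (GoodFrom p q)
goodFrom? p q w = All.all? inQuadrant? (visited p w) ×-dec (endpoint p w ≟ₚ q)

goodFrom-∷ : ∀ {p q s} → InQuadrant (p ⊕ s) → GoodFrom p q ∘ (s ∷_) ≐ GoodFrom (p ⊕ s) q
goodFrom-∷ p⊕s∈ℕ² = (λ { (_ ∷ stays , ends) → stays , ends })
                   , (λ { (stays , ends) → p⊕s∈ℕ² ∷ stays , ends })

length-filter-goodFrom-∷ : ∀ p q s W →
  length (filter (goodFrom? p q) (map (s ∷_) W))
    ≡ ifInQuadrant (p ⊕ s) (length (filter (goodFrom? (p ⊕ s) q) W))
length-filter-goodFrom-∷ p q s W =
  trans (length-filter-map (goodFrom? p q) (s ∷_) W) (byDecision (inQuadrant? (p ⊕ s)))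
  where
  byDecision : (d : Dec (InQuadrant (p ⊕ s))) → length (filter (goodFrom? p q ∘ (s ∷_)) W)
                 ≡ (if does d then length (filter (goodFrom? (p ⊕ s) q) W) else 0)
  byDecision (yes p⊕s∈ℕ²) = cong length (filter-≐ _ _ (goodFrom-∷ {p} {q} {s} p⊕s∈ℕ²) W)
  byDecision (no  p⊕s∉ℕ²) = cong length (filter-none _ (All.universal leaves W))
    where
    leaves : ∀ w → ¬ GoodFrom p q (s ∷ w)
    leaves w (p⊕s∈ℕ² ∷ _ , _) = p⊕s∉ℕ² p⊕s∈ℕ²

length-filter-goodFrom-words : ∀ S q n p →
  length (filter (goodFrom? p q) (words S n)) ≡ quadrantWalks S q n p
length-filter-goodFrom-words S q zero p with p ≟ₚ q
... | yes _ = refl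
... | no  _ = refl
length-filter-goodFrom-words S q (suc n) p = begin
  length (filter (goodFrom? p q) (concatMap (λ s → map (s ∷_) (words S n)) S))
    ≡⟨ length-filter-concatMap (goodFrom? p q) (λ s → map (s ∷_) (words S n)) S ⟩
  sum (map (λ s → length (filter (goodFrom? p q) (map (s ∷_) (words S n)))) S)
    ≡⟨ cong sum (map-cong firstStep S) ⟩
  quadrantWalks S q (suc n) p ∎
  where
  open ≡-Reasoning
  firstStep : ∀ s → length (filter (goodFrom? p q) (map (s ∷_) (words S n)))
                  ≡ ifInQuadrant (p ⊕ s) (quadrantWalks S q n (p ⊕ s))
  firstStep s = trans (length-filter-goodFrom-∷ p q s (words S n))
                      (cong (ifInQuadrant (p ⊕ s)) (length-filter-goodFrom-words S q n (p ⊕ s)))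

count≡quadrantWalks : ∀ S n i j → count S n i j ≡ quadrantWalks (steps S) (ℤ.+ i , ℤ.+ j) n origin
count≡quadrantWalks S n i j = length-filter-goodFrom-words (steps S) (ℤ.+ i , ℤ.+ j) n origin

-- 2^N · Σ_{n ≤ N} 2^(-n) · quadrantWalks S q n p, with the denominators cleared.
scaledPartialSum : List Point → Point → ℕ → Point → ℕ
scaledPartialSum S q zero    p = quadrantWalks S q zero p
scaledPartialSum S q (suc N) p = 2 * scaledPartialSum S q N p + quadrantWalks S q (suc N) p

scaledPartialSum-suc : ∀ S q N p → scaledPartialSum S q (suc N) p
  ≡ 2 ^ suc N * quadrantWalks S q 0 p
    + sum (map (λ s → ifInQuadrant (p ⊕ s) (scaledPartialSum S q N (p ⊕ s))) S)
scaledPartialSum-suc S q zero    p = refl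
scaledPartialSum-suc S q (suc N) p = begin
  2 * T (suc N) p + W (suc (suc N)) p
    ≡⟨ cong (λ v → 2 * v + W (suc (suc N)) p) (scaledPartialSum-suc S q N p) ⟩
  2 * (2 ^ suc N * W 0 p + Σ (step (T N))) + Σ (step (W (suc N)))
    ≡⟨ regroup (2 ^ suc N) (W 0 p) _ _ ⟩
  2 ^ suc (suc N) * W 0 p + (2 * Σ (step (T N)) + Σ (step (W (suc N))))
    ≡⟨ cong (2 ^ suc (suc N) * W 0 p +_) (sum-map-+-* 2 (step (T N)) (step (W (suc N))) S) ⟨
  2 ^ suc (suc N) * W 0 p + Σ (λ s → 2 * step (T N) s + step (W (suc N)) s)
    ≡⟨ cong (λ v → 2 ^ suc (suc N) * W 0 p + sum v)
            (map-cong (λ s → ifInQuadrant-+-* (p ⊕ s) 2 _ _) S) ⟨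
  2 ^ suc (suc N) * W 0 p + Σ (step (T (suc N))) ∎
  where
  open ≡-Reasoning
  W = quadrantWalks S q
  T = scaledPartialSum S q
  step : (Point → ℕ) → Point → ℕ
  step f s = ifInQuadrant (p ⊕ s) (f (p ⊕ s))
  Σ : (Point → ℕ) → ℕ
  Σ f = sum (map f S)
  regroup : ∀ X c A B → 2 * (X * c + A) + B ≡ 2 * X * c + (2 * A + B)
  regroup = solve-∀

Supersolution : List Point → Point → (Point → ℕ) → Set
Supersolution S q h =
  ∀ p → InQuadrant p → 2 * quadrantWalks S q 0 p + sum (map (λ s → h (p ⊕ s)) S) ≤ 2 * h p

Supersolution-⊆ : ∀ {S T q h} → S ⊆ T → Supersolution T q h → Supersolution S q h
Supersolution-⊆ {S} {T} {q} {h} S⊆T hT p p∈ℕ² =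
  ℕP.≤-trans (ℕP.+-monoʳ-≤ (2 * quadrantWalks S q 0 p) (sum-map-⊆ (λ s → h (p ⊕ s)) S⊆T))
             (hT p p∈ℕ²)

scaledPartialSum≤ : ∀ {S q h} → Supersolution S q h →
                    ∀ N p → InQuadrant p → scaledPartialSum S q N p ≤ 2 ^ N * h p
scaledPartialSum≤ {S} {q} {h} sup zero p p∈ℕ² = begin
  quadrantWalks S q 0 p ≤⟨ ℕP.*-cancelˡ-≤ 2 (ℕP.≤-trans (ℕP.m≤m+n _ _) (sup p p∈ℕ²)) ⟩
  h p                   ≡⟨ ℕP.*-identityˡ (h p) ⟨
  1 * h p               ∎
  where open ℕP.≤-Reasoning
scaledPartialSum≤ {S} {q} {h} sup (suc N) p p∈ℕ² = begin
  scaledPartialSum S q (suc N) p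
    ≡⟨ scaledPartialSum-suc S q N p ⟩
  2 ^ suc N * W₀ + sum (map (λ s → ifInQuadrant (p ⊕ s) (scaledPartialSum S q N (p ⊕ s))) S)
    ≤⟨ ℕP.+-monoʳ-≤ (2 ^ suc N * W₀) (sum-map-mono-≤ induction S) ⟩
  2 ^ suc N * W₀ + sum (map (λ s → 2 ^ N * h (p ⊕ s)) S)
    ≡⟨ cong (2 ^ suc N * W₀ +_) (sum-map-*ˡ (2 ^ N) (λ s → h (p ⊕ s)) S) ⟩
  2 ^ suc N * W₀ + 2 ^ N * sum (map (λ s → h (p ⊕ s)) S)
    ≡⟨ factor (2 ^ N) W₀ _ ⟩
  2 ^ N * (2 * W₀ + sum (map (λ s → h (p ⊕ s)) S))
    ≤⟨ ℕP.*-monoʳ-≤ (2 ^ N) (sup p p∈ℕ²) ⟩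
  2 ^ N * (2 * h p)
    ≡⟨ double (2 ^ N) (h p) ⟩
  2 ^ suc N * h p ∎
  where
  open ℕP.≤-Reasoning
  W₀ = quadrantWalks S q 0 p
  induction : ∀ s → ifInQuadrant (p ⊕ s) (scaledPartialSum S q N (p ⊕ s)) ≤ 2 ^ N * h (p ⊕ s)
  induction s = ifInQuadrant-≤ (p ⊕ s) (scaledPartialSum≤ {S} {q} {h} sup N (p ⊕ s))
  factor : ∀ X c A → 2 * X * c + X * A ≡ X * (2 * c + A)
  factor = solve-∀
  double : ∀ X c → X * (2 * c) ≡ 2 * X * c
  double = solve-∀

-- c ^ (L ∸ k) for k ≤ L, and 0 for k > L.
truncatedPower : ℕ → ℕ → ℕ → ℕ
truncatedPower c zero    zero    = 1
truncatedPower c zero    (suc k) = 0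
truncatedPower c (suc L) zero    = c * truncatedPower c L zero
truncatedPower c (suc L) (suc k) = truncatedPower c L k

truncatedPower-step : ∀ c L k → c * truncatedPower c L (suc k) ≤ truncatedPower c L k
truncatedPower-step c zero    k       = ℕP.≤-trans (ℕP.≤-reflexive (ℕP.*-zeroʳ c)) z≤n
truncatedPower-step c (suc L) zero    = ℕP.≤-refl
truncatedPower-step c (suc L) (suc k) = truncatedPower-step c L k

truncatedPower-suc≤ : ∀ c .{{_ : ℕ.NonZero c}} L k →
                      truncatedPower c L (suc k) ≤ truncatedPower c L k
truncatedPower-suc≤ c L k = ℕP.≤-trans (ℕP.m≤n*m _ c) (truncatedPower-step c L k)

truncatedPower-beyond : ∀ c {L k} → L < k → truncatedPower c L k ≡ 0
truncatedPower-beyond c {zero}  {suc k} _         = refl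
truncatedPower-beyond c {suc L} {suc k} (s≤s L<k) = truncatedPower-beyond c L<k

truncatedPower-diag : ∀ c L → truncatedPower c L L ≡ 1
truncatedPower-diag c zero    = refl
truncatedPower-diag c (suc L) = truncatedPower-diag c L

*-truncatedPower-monoˡ-≤ : ∀ c {L k m n} → (k ≤ L → m ≤ n) →
                           m * truncatedPower c L k ≤ n * truncatedPower c L k
*-truncatedPower-monoˡ-≤ c {L} {k} {m} {n} m≤n with k ℕ.≤? L
... | yes k≤L = ℕP.*-monoˡ-≤ _ (m≤n k≤L)
... | no  k≰L rewrite truncatedPower-beyond c (ℕP.≰⇒> k≰L) | ℕP.*-zeroʳ m = z≤n

suc*suc≤ : ∀ a b {K} → a + b ≤ K → suc a * suc b ≤ suc K * suc K
suc*suc≤ a b a+b≤K =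
  ℕP.*-mono-≤ (s≤s (ℕP.≤-trans (ℕP.m≤m+n a b) a+b≤K))
              (s≤s (ℕP.≤-trans (ℕP.m≤n+m b a) a+b≤K))

module Potential (i j : ℕ) where

  K M c : ℕ
  K = i + j
  M = suc K * suc K
  c = 2 * M

  g : ℕ → ℕ
  g = truncatedPower c K

  potential : Point → ℕ
  potential (ℤ.+ x , ℤ.+ y) = suc x * suc y * g (x + y)
  potential _               = 0

  potential-NW : ∀ x y → potential ((ℤ.+ x , ℤ.+ y) ⊕ NW) ≡ x * (2 + y) * g (x + y)
  potential-NW zero    y = refl
  potential-NW (suc x) y rewrite ℕP.+-comm y 1 | ℕP.+-suc x y = refl

  potential-SE : ∀ x y → potential ((ℤ.+ x , ℤ.+ y) ⊕ SE) ≡ (2 + x) * y * g (x + y)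
  potential-SE x zero    rewrite ℕP.*-zeroʳ (2 + x) = refl
  potential-SE x (suc y) rewrite ℕP.+-comm x 1 | ℕP.+-suc x y = refl

  potential-N : ∀ x y → potential ((ℤ.+ x , ℤ.+ y) ⊕ N) ≡ suc x * (2 + y) * g (1 + (x + y))
  potential-N x y rewrite ℕP.+-identityʳ x | ℕP.+-comm y 1 | ℕP.+-suc x y = refl

  potential-E : ∀ x y → potential ((ℤ.+ x , ℤ.+ y) ⊕ E) ≡ (2 + x) * suc y * g (1 + (x + y))
  potential-E x y rewrite ℕP.+-identityʳ y | ℕP.+-comm x 1 = refl

  potential-NE : ∀ x y → potential ((ℤ.+ x , ℤ.+ y) ⊕ NE) ≡ (2 + x) * (2 + y) * g (2 + (x + y))
  potential-NE x y rewrite ℕP.+-comm y 1 | ℕP.+-comm x 1 | ℕP.+-suc x y = refl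

  upward : ℕ → ℕ → ℕ
  upward x y = suc x * (2 + y) * g (1 + (x + y)) + (2 + x) * (2 + y) * g (2 + (x + y))
             + (2 + x) * suc y * g (1 + (x + y))

  upward≤ : ∀ x y → upward x y ≤ 2 * g (x + y)
  upward≤ x y = begin
    upward x y
      ≤⟨ ℕP.+-mono-≤ (ℕP.+-mono-≤ (absorb coeff-N) (absorb coeff-NE)) (absorb coeff-E) ⟩
    M * g (1 + k) + M * g (2 + k) + M * g (1 + k)
      ≡⟨ regroup M (g (1 + k)) (g (2 + k)) ⟩
    c * g (1 + k) + M * g (2 + k)
      ≤⟨ ℕP.+-monoʳ-≤ (c * g (1 + k)) (ℕP.*-monoˡ-≤ (g (2 + k)) (ℕP.m≤m+n M (M + 0))) ⟩
    c * g (1 + k) + c * g (2 + k)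
      ≤⟨ ℕP.+-mono-≤ (truncatedPower-step c K k) (truncatedPower-step c K (1 + k)) ⟩
    g k + g (1 + k)
      ≤⟨ ℕP.+-monoʳ-≤ (g k) (truncatedPower-suc≤ c K k) ⟩
    g k + g k
      ≡⟨ cong (g k +_) (ℕP.+-identityʳ (g k)) ⟨
    2 * g k ∎
    where
    open ℕP.≤-Reasoning
    k = x + y
    absorb : ∀ {l m} → (l ≤ K → m ≤ M) → m * g l ≤ M * g l
    absorb = *-truncatedPower-monoˡ-≤ c
    coeff-N : 1 + k ≤ K → suc x * (2 + y) ≤ M
    coeff-N 1+k≤K = suc*suc≤ x (suc y) (subst (_≤ K) (sym (ℕP.+-suc x y)) 1+k≤K)
    coeff-NE : 2 + k ≤ K → (2 + x) * (2 + y) ≤ M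
    coeff-NE 2+k≤K = suc*suc≤ (suc x) (suc y) (subst (_≤ K) (sym (cong suc (ℕP.+-suc x y))) 2+k≤K)
    coeff-E : 1 + k ≤ K → (2 + x) * suc y ≤ M
    coeff-E = suc*suc≤ (suc x) y
    regroup : ∀ M u v → M * u + M * v + M * u ≡ 2 * M * u + M * v
    regroup = solve-∀

  upward-top : upward i j ≡ 0
  upward-top = begin
    upward i j
      ≡⟨ cong₂ (λ u v → suc i * (2 + j) * u + (2 + i) * (2 + j) * v + (2 + i) * suc j * u)
               (truncatedPower-beyond c (ℕP.n<1+n K))
               (truncatedPower-beyond c (ℕP.m<n⇒m<1+n (ℕP.n<1+n K))) ⟩
    suc i * (2 + j) * 0 + (2 + i) * (2 + j) * 0 + (2 + i) * suc j * 0
      ≡⟨ annihilate (suc i * (2 + j)) ((2 + i) * (2 + j)) ((2 + i) * suc j) ⟩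
    0 ∎
    where
    open ≡-Reasoning
    annihilate : ∀ a b d → a * 0 + b * 0 + d * 0 ≡ 0
    annihilate = solve-∀

  target : Point
  target = (ℤ.+ i , ℤ.+ j)

  source+upward≤ : ∀ x y (d : Dec ((ℤ.+ x , ℤ.+ y) ≡ target)) →
                   2 * (if does d then 1 else 0) + upward x y ≤ 2 * g (x + y)
  source+upward≤ x y (no  _)    = upward≤ x y
  source+upward≤ _ _ (yes refl) =
    ℕP.≤-reflexive (trans (cong (2 +_) upward-top) (cong (2 *_) (sym (truncatedPower-diag c K))))

  supersolution-𝒞 : Supersolution (steps 𝒞) target potential
  supersolution-𝒞 p@(ℤ.+ x , ℤ.+ y) (ℤ.+≤+ _ , ℤ.+≤+ _) = begin
    2 * δ + sum (map (λ s → potential (p ⊕ s)) (steps 𝒞))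
      ≡⟨ cong (λ v → 2 * δ + v) neighbours ⟩
    2 * δ + (x * (2 + y) * g k + (n + (ne + (e + ((2 + x) * y * g k + 0)))))
      ≡⟨ regroup δ (x * (2 + y) * g k) n ne e ((2 + x) * y * g k) ⟩
    (x * (2 + y) * g k + (2 + x) * y * g k) + (2 * δ + upward x y)
      ≤⟨ ℕP.+-monoʳ-≤ (x * (2 + y) * g k + (2 + x) * y * g k)
                      (source+upward≤ x y (p ≟ₚ target)) ⟩
    (x * (2 + y) * g k + (2 + x) * y * g k) + 2 * g k
      ≡⟨ level x y (g k) ⟩
    2 * potential p ∎
    where
    open ℕP.≤-Reasoning
    k = x + y
    δ = quadrantWalks (steps 𝒞) target 0 p
    n = suc x * (2 + y) * g (1 + k)
    ne = (2 + x) * (2 + y) * g (2 + k)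
    e = (2 + x) * suc y * g (1 + k)
    neighbours : sum (map (λ s → potential (p ⊕ s)) (steps 𝒞))
               ≡ x * (2 + y) * g k + (n + (ne + (e + ((2 + x) * y * g k + 0))))
    neighbours = cong₂ _+_ (potential-NW x y)
                  (cong₂ _+_ (potential-N x y)
                  (cong₂ _+_ (potential-NE x y)
                  (cong₂ _+_ (potential-E x y)
                  (cong (_+ 0) (potential-SE x y)))))
    regroup : ∀ δ nw n ne e se →
              2 * δ + (nw + (n + (ne + (e + (se + 0))))) ≡ (nw + se) + (2 * δ + (n + ne + e))
    regroup = solve-∀
    level : ∀ x y G → (x * (2 + y) * G + (2 + x) * y * G) + 2 * G ≡ 2 * (suc x * suc y * G)
    level = solve-∀

steps⊆𝒞 : ∀ S → steps S ⊆ steps 𝒞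
steps⊆𝒞 𝒜 = refl ∷ N ∷ʳ refl ∷ E ∷ʳ refl ∷ []
steps⊆𝒞 ℬ = refl ∷ refl ∷ NE ∷ʳ refl ∷ refl ∷ []
steps⊆𝒞 𝒞 = refl ∷ refl ∷ refl ∷ refl ∷ refl ∷ []
steps⊆𝒞 𝒟 = refl ∷ refl ∷ NE ∷ʳ E ∷ʳ refl ∷ []
steps⊆𝒞 ℰ = refl ∷ refl ∷ refl ∷ E ∷ʳ refl ∷ []

supersolution : ∀ S i j → Supersolution (steps S) (ℤ.+ i , ℤ.+ j) (Potential.potential i j)
supersolution S i j =
  Supersolution-⊆ {h = Potential.potential i j} (steps⊆𝒞 S) (Potential.supersolution-𝒞 i j)

fromℕ : ℕ → ℚ
fromℕ n = ℤ.+ n ℚ./ 1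

toℚᵘ-fromℕ : ∀ n → ℚ.toℚᵘ (fromℕ n) ℚᵘ.≃ ℚᵘ.mkℚᵘ (ℤ.+ n) 0
toℚᵘ-fromℕ n = ℚP.toℚᵘ-fromℚᵘ (ℚᵘ.mkℚᵘ (ℤ.+ n) 0)

fromℕ-homo-+ : ∀ m n → fromℕ (m + n) ≡ fromℕ m ℚ.+ fromℕ n
fromℕ-homo-+ m n = ℚP.toℚᵘ-injective (begin
  ℚ.toℚᵘ (fromℕ (m + n))
    ≈⟨ toℚᵘ-fromℕ (m + n) ⟩
  ℚᵘ.mkℚᵘ (ℤ.+ (m + n)) 0
    ≈⟨ ℚᵘ.*≡* (cong (ℤ._* ℤ.+ 1) (sym (cong₂ ℤ._+_ (ℤP.*-identityʳ (ℤ.+ m))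
                                                  (ℤP.*-identityʳ (ℤ.+ n))))) ⟩
  ℚᵘ.mkℚᵘ (ℤ.+ m) 0 ℚᵘ.+ ℚᵘ.mkℚᵘ (ℤ.+ n) 0
    ≈⟨ ℚᵘP.+-cong (toℚᵘ-fromℕ m) (toℚᵘ-fromℕ n) ⟨
  ℚ.toℚᵘ (fromℕ m) ℚᵘ.+ ℚ.toℚᵘ (fromℕ n)
    ≈⟨ ℚP.toℚᵘ-homo-+ (fromℕ m) (fromℕ n) ⟨
  ℚ.toℚᵘ (fromℕ m ℚ.+ fromℕ n) ∎)
  where open ℚᵘP.≃-Reasoning

fromℕ-homo-* : ∀ m n → fromℕ (m * n) ≡ fromℕ m ℚ.* fromℕ n
fromℕ-homo-* m n = ℚP.toℚᵘ-injective (begin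
  ℚ.toℚᵘ (fromℕ (m * n))
    ≈⟨ toℚᵘ-fromℕ (m * n) ⟩
  ℚᵘ.mkℚᵘ (ℤ.+ (m * n)) 0
    ≈⟨ ℚᵘ.*≡* (cong (ℤ._* ℤ.+ 1) (ℤP.pos-* m n)) ⟩
  ℚᵘ.mkℚᵘ (ℤ.+ m) 0 ℚᵘ.* ℚᵘ.mkℚᵘ (ℤ.+ n) 0
    ≈⟨ ℚᵘP.*-cong (toℚᵘ-fromℕ m) (toℚᵘ-fromℕ n) ⟨
  ℚ.toℚᵘ (fromℕ m) ℚᵘ.* ℚ.toℚᵘ (fromℕ n)
    ≈⟨ ℚP.toℚᵘ-homo-* (fromℕ m) (fromℕ n) ⟨
  ℚ.toℚᵘ (fromℕ m ℚ.* fromℕ n) ∎)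
  where open ℚᵘP.≃-Reasoning

fromℕ-mono-≤ : ∀ {m n} → m ≤ n → fromℕ m ℚ.≤ fromℕ n
fromℕ-mono-≤ {m} {n} m≤n = ℚP.toℚᵘ-cancel-≤ (begin
  ℚ.toℚᵘ (fromℕ m)   ≃⟨ toℚᵘ-fromℕ m ⟩
  ℚᵘ.mkℚᵘ (ℤ.+ m) 0  ≤⟨ ℚᵘ.*≤* (ℤP.*-monoʳ-≤-nonNeg (ℤ.+ 1) (ℤ.+≤+ m≤n)) ⟩
  ℚᵘ.mkℚᵘ (ℤ.+ n) 0  ≃⟨ toℚᵘ-fromℕ n ⟨
  ℚ.toℚᵘ (fromℕ n)   ∎)
  where open ℚᵘP.≤-Reasoning

half^-nonNeg : ∀ N → ℚ.NonNegative (half^ N)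
half^-nonNeg zero    = _
half^-nonNeg (suc N) = ℚP.nonNeg*nonNeg⇒nonNeg ½ (half^ N) {{half^-nonNeg N}}

fromℕ-2*-+-*½ : ∀ a b r →
  fromℕ a ℚ.* r ℚ.+ fromℕ b ℚ.* (½ ℚ.* r) ≡ fromℕ (2 * a + b) ℚ.* (½ ℚ.* r)
fromℕ-2*-+-*½ a b r = begin
  fromℕ a ℚ.* r ℚ.+ fromℕ b ℚ.* (½ ℚ.* r)
    ≡⟨ cong (λ u → u ℚ.* r ℚ.+ fromℕ b ℚ.* (½ ℚ.* r)) (ℚP.*-identityˡ (fromℕ a)) ⟨
  (fromℕ 2 ℚ.* ½) ℚ.* fromℕ a ℚ.* r ℚ.+ fromℕ b ℚ.* (½ ℚ.* r)
    ≡⟨ solve 5 (λ t y a b r → (t :* y) :* a :* r :+ b :* (y :* r) := (t :* a :+ b) :* (y :* r))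
             refl (fromℕ 2) ½ (fromℕ a) (fromℕ b) r ⟩
  (fromℕ 2 ℚ.* fromℕ a ℚ.+ fromℕ b) ℚ.* (½ ℚ.* r)
    ≡⟨ cong (ℚ._* (½ ℚ.* r))
            (trans (fromℕ-homo-+ (2 * a) b) (cong (ℚ._+ fromℕ b) (fromℕ-homo-* 2 a))) ⟨
  fromℕ (2 * a + b) ℚ.* (½ ℚ.* r) ∎
  where
  open ≡-Reasoning
  open +-*-Solver

fromℕ-2^*-*half^ : ∀ N m → fromℕ (2 ^ N * m) ℚ.* half^ N ≡ fromℕ m
fromℕ-2^*-*half^ zero    m = trans (ℚP.*-identityʳ _) (cong fromℕ (ℕP.*-identityˡ m))
fromℕ-2^*-*half^ (suc N) m = begin
  fromℕ (2 ^ suc N * m) ℚ.* (½ ℚ.* half^ N)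
    ≡⟨ cong (λ v → fromℕ v ℚ.* (½ ℚ.* half^ N)) (ℕP.*-assoc 2 (2 ^ N) m) ⟩
  fromℕ (2 * (2 ^ N * m)) ℚ.* (½ ℚ.* half^ N)
    ≡⟨ cong (ℚ._* (½ ℚ.* half^ N)) (fromℕ-homo-* 2 (2 ^ N * m)) ⟩
  fromℕ 2 ℚ.* fromℕ (2 ^ N * m) ℚ.* (½ ℚ.* half^ N)
    ≡⟨ solve 4 (λ t a y r → t :* a :* (y :* r) := (t :* y) :* (a :* r))
             refl (fromℕ 2) (fromℕ (2 ^ N * m)) ½ (half^ N) ⟩
  (fromℕ 2 ℚ.* ½) ℚ.* (fromℕ (2 ^ N * m) ℚ.* half^ N)
    ≡⟨ cong (1ℚ ℚ.*_) (fromℕ-2^*-*half^ N m) ⟩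
  1ℚ ℚ.* fromℕ m
    ≡⟨ ℚP.*-identityˡ (fromℕ m) ⟩
  fromℕ m ∎
  where
  open ≡-Reasoning
  open +-*-Solver

partialCoeff≡scaledPartialSum : ∀ S i j N →
  partialCoeff S i j N ≡ fromℕ (scaledPartialSum (steps S) (ℤ.+ i , ℤ.+ j) N origin) ℚ.* half^ N
partialCoeff≡scaledPartialSum S i j zero =
  trans (cong fromℕ (count≡quadrantWalks S 0 i j)) (sym (ℚP.*-identityʳ _))
partialCoeff≡scaledPartialSum S i j (suc N) = trans
  (cong₂ (λ u v → u ℚ.+ fromℕ v ℚ.* half^ (suc N))
         (partialCoeff≡scaledPartialSum S i j N) (count≡quadrantWalks S (suc N) i j))
  (fromℕ-2*-+-*½ (scaledPartialSum (steps S) q N origin)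
                 (quadrantWalks (steps S) q (suc N) origin) (half^ N))
  where q = (ℤ.+ i , ℤ.+ j)

proposition2p2 : (S : Model) (i j : ℕ) →
    ∃ λ (B : ℚ) → ∀ (N : ℕ) → partialCoeff S i j N ℚ.≤ B
proposition2p2 S i j = fromℕ H , bound
  where
  h = Potential.potential i j
  H = h origin
  origin∈ℕ² : InQuadrant origin
  origin∈ℕ² = ℤ.+≤+ z≤n , ℤ.+≤+ z≤n
  bound : ∀ N → partialCoeff S i j N ℚ.≤ fromℕ H
  bound N = begin
    partialCoeff S i j N
      ≡⟨ partialCoeff≡scaledPartialSum S i j N ⟩
    fromℕ (scaledPartialSum (steps S) (ℤ.+ i , ℤ.+ j) N origin) ℚ.* half^ N
      ≤⟨ ℚP.*-monoʳ-≤-nonNeg (half^ N) {{half^-nonNeg N}}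
           (fromℕ-mono-≤ (scaledPartialSum≤ {h = h} (supersolution S i j) N origin origin∈ℕ²)) ⟩
    fromℕ (2 ^ N * H) ℚ.* half^ N
      ≡⟨ fromℕ-2^*-*half^ N H ⟩
    fromℕ H ∎
    where open ℚP.≤-Reasoning
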